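{- Let $m,n\ge1$ and $d=\gcd(m,n)$. Then there exists $g$ in the monoid $\mathcal B_3^+$ (generated by $\tau_+,\tau_-$) such that the corresponding element of $\mathrm{SL}_2(\mathbb Z)$ sends $(d,0)$ to $(m,n)$. For any such $g$ and any $N\ge1$, $$g\big(D^{(N)}_{d,0}\big)=D^{(N)}_{m,n}.$$
   Context: Let $N\ge1$. The double affine Hecke algebra $\ddot{\mathbf H}_{N;q,t}$ is the $\mathbb C(q^{1/2},t^{1/2})$-algebra generated by $X_i^{\pm1},Y_i^{\pm1}$ ($1\le i\le N$) and $T_i$ ($1\le i\le N-1$) subject to: $(T_i+t^{1/2})(T_i-t^{ -1/2})=0$; $T_iT_{i+1}T_i=T_{i+1}T_iT_{i+1}$; $T_iT_k=T_kT_i$ if $|i-k|>1$; the $X_j$ pairwise commute and the $Y_j$ pairwise commute; $T_iX_iT_i=X_{i+1}$, $T_i^{ -1}Y_iT_i^{ -1}=Y_{i+1}$; $T_iX_k=X_kT_i$, $T_iY_k=Y_kT_i$ if $|i-k|>1$; $Y_1X_1\cdots X_N=qX_1\cdots X_NY_1$; $X_1^{ -1}Y_2=Y_2X_1^{ -1}T_1^{ -2}$. Let $e_N=\big(\sum_{w\in\mathfrak S_N}t^{ -\ell(w)/2}T_w\big)/\big(\sum_{w}t^{ -\ell(w)}\big)$ and $\gamma_{N;t}=1-t^N$. The braid group $\mathcal B_3=\langle\tau_+,\tau_-\mid\tau_+\tau_-^{ -1}\tau_+=\tau_-^{ -1}\tau_+\tau_-^{ -1}\rangle$ acts on $\ddot{\mathbf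 H}_{N;q,t}$ by $\tau_+(T_i)=T_i$, $\tau_+(X_i)=X_i$, $\tau_+(Y_i)=Y_iX_i(T_{i-1}^{ -1}\cdots T_1^{ -1})(T_1^{ -1}\cdots T_{i-1}^{ -1})$, $\tau_-(T_i)=T_i$, $\tau_-(Y_i)=Y_i$, $\tau_-(X_i)=X_iY_i(T_{i-1}\cdots T_1)(T_1\cdots T_{i-1})$, and maps to $\mathrm{SL}_2(\mathbb Z)$ by $\tau_+\mapsto\begin{pmatrix}1&1\\0&1\end{pmatrix}$, $\tau_-\mapsto\begin{pmatrix}1&0\\1&1\end{pmatrix}$. For $d\ge1$, $D^{(N)}_{d,0}:=\gamma_{N;t}e_NY_1X_1^dY_1^{ -1}e_N$. For $m,n\ge1$, $D^{(N)}_{m,n}$ is defined as follows. Let $C$ be an almost linear curve from $(0,0)$ to $(m,n)$: the graph of a strictly increasing continuous $f:[0,m]\to[0,n]$, $f(0)=0,f(m)=n$, passing through no lattice points except its endpoints, passing above each of the $\gcd(m,n)-1$ interior lattice points of the diagonal from $(0,0)$ to $(m,n)$, and above (resp. below) all lattice points strictly below (resp. above) the diagonal. Let $\mathcal P_C$ be the highest up-right lattice path from $(0,0)$ to $(m,n)$ weakly below $C$. Then $D^{(N)}_{m,n}$ is the product, in the order encountered traversing $\mathcal P_C$, of $\gamma_{N;t}e_N$ at $(0,0)$, $Y_1$ for each up step, $Y_1X_1Y_1^{ -1}$ for each right step, and $e_N$ at $(m,n)$. -}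

module Defs where

open import Level using (Level; _⊔_)
open import Data.Bool using (Bool; true; false; if_then_else_; _∧_)
open import Data.Nat as ℕ using (ℕ; zero; suc; _<_; _≤?_)
open import Data.Fin using (Fin; zero; suc; toℕ; inject₁)
open import Data.List using (List; []; _∷_; _++_; reverse; map; foldr; length; allFin)
open import Data.Integer as ℤ using (ℤ)
open import Data.Product using (_×_; _,_)
open import Data.Sum using (_⊎_)
open import Relation.Nullary using (does)
open import Relation.Binary.PropositionalEquality using (_≡_)
open import Algebra.Bundles using (Ring)

-- Conventions.  N = suc k  (so N ≥ 1).  Indices are 0-based:
--   X_i, Y_i  (1 ≤ i ≤ N)   ↦  Fin (suc k), X_i = X (i-1)
--   T_i       (1 ≤ i ≤ N-1) ↦  Fin k,       T_i = T (i-1)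

Far : ℕ → ℕ → Set
Far a b = suc a < b ⊎ suc b < a

data Letter (k : ℕ) : Set where
  X X⁻ Y Y⁻ : Fin (suc k) → Letter k
  T T⁻      : Fin k → Letter k

invLetter : ∀ {k} → Letter k → Letter k
invLetter (X i)  = X⁻ i
invLetter (X⁻ i) = X i
invLetter (Y i)  = Y⁻ i
invLetter (Y⁻ i) = Y i
invLetter (T i)  = T⁻ i
invLetter (T⁻ i) = T i

invWord : ∀ {k} → List (Letter k) → List (Letter k)
invWord w = reverse (map invLetter w)

-- below i = [0, 1, …, toℕ i - 1] as indices of T's, i.e. the 1-based
-- indices 1, …, i-1 when i is the 1-based index of X_i / Y_i
below : ∀ {k} → Fin (suc k) → List (Fin k)
below zero = []
below {suc k} (suc i) = zero ∷ map suc (below i)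

data Term {s : Level} (S : Set s) (k : ℕ) : Set s where
  lit  : S → Term S k
  gen  : Letter k → Term S k
  zro one : Term S k
  _⊕_ _⊗_ : Term S k → Term S k → Term S k

infixl 6 _⊕_
infixl 7 _⊗_

word : ∀ {s} {S : Set s} {k} → List (Letter k) → Term S k
word = foldr (λ l t → gen l ⊗ t) one

sumT : ∀ {s} {S : Set s} {k} → List (Term S k) → Term S k
sumT = foldr _⊕_ zro

prodT : ∀ {s} {S : Set s} {k} → List (Term S k) → Term S k
prodT = foldr _⊗_ one

powT : ∀ {s} {S : Set s} {k} → Term S k → ℕ → Term S k
powT t zero = one
powT t (suc d) = t ⊗ powT t d

-- The braid group B_3 and its positive monoid B_3^+ :
-- an element of B_3^+ is represented by a positive word in τ₊, τ₋,
-- the word  b₁ ∷ b₂ ∷ … ∷ bₗ  standing for the product b₁ b₂ ⋯ bₗ.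

data BG : Set where
  τ₊ τ₋ : BG

actLetter : ∀ {k} → BG → Letter k → List (Letter k)
actLetter τ₊ (Y i)  = Y i ∷ X i ∷ (map T⁻ (reverse (below i)) ++ map T⁻ (below i))
actLetter τ₊ (Y⁻ i) = invWord (actLetter τ₊ (Y i))
actLetter τ₊ l      = l ∷ []
actLetter τ₋ (X i)  = X i ∷ Y i ∷ (map T (reverse (below i)) ++ map T (below i))
actLetter τ₋ (X⁻ i) = invWord (actLetter τ₋ (X i))
actLetter τ₋ l      = l ∷ []

actB : ∀ {s} {S : Set s} {k} → BG → Term S k → Term S k
actB b (lit s)   = lit s
actB b (gen l)   = word (actLetter b l)
actB b zro       = zro
actB b one       = one
actB b (t ⊕ u)   = actB b t ⊕ actB b u
actB b (t ⊗ u)   = actB b t ⊗ actB b u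

act : ∀ {s} {S : Set s} {k} → List BG → Term S k → Term S k
act [] t = t
act (b ∷ g) t = actB b (act g t)

record Mat2 : Set where
  constructor mat
  field a b c d : ℤ

_·M_ : Mat2 → Mat2 → Mat2
mat a b c d ·M mat a' b' c' d' =
  mat (a ℤ.* a' ℤ.+ b ℤ.* c') (a ℤ.* b' ℤ.+ b ℤ.* d')
      (c ℤ.* a' ℤ.+ d ℤ.* c') (c ℤ.* b' ℤ.+ d ℤ.* d')

matBG : BG → Mat2
matBG τ₊ = mat (ℤ.+ 1) (ℤ.+ 1) (ℤ.+ 0) (ℤ.+ 1)
matBG τ₋ = mat (ℤ.+ 1) (ℤ.+ 0) (ℤ.+ 1) (ℤ.+ 1)

matOf : List BG → Mat2
matOf [] = mat (ℤ.+ 1) (ℤ.+ 0) (ℤ.+ 0) (ℤ.+ 1)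
matOf (b ∷ g) = matBG b ·M matOf g

_▷_ : Mat2 → ℤ × ℤ → ℤ × ℤ
mat a b c d ▷ (x , y) = (a ℤ.* x ℤ.+ b ℤ.* y , c ℤ.* x ℤ.+ d ℤ.* y)

-- A lattice point (a,b) in [0,m]×[0,n] lies weakly
-- below an almost linear curve C from (0,0) to (m,n) iff  b·m ≤ a·n
-- (C passes above the lattice points on or below the diagonal and below
-- those strictly above it); an up-right lattice path is weakly below C iff
-- all its vertices are.  The highest such path is obtained greedily:
-- step up whenever the point above is allowed, otherwise step right.

data Step : Set where
  up right : Step

pathFrom : (m n : ℕ) → (fuel a b : ℕ) → List Step
pathFrom m n zero a b = []
pathFrom m n (suc f) a b =
  if does (suc b ≤? n) ∧ does (suc b ℕ.* m ≤? a ℕ.* n)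
  then up ∷ pathFrom m n f a (suc b)
  else right ∷ pathFrom m n f (suc a) b

pathC : (m n : ℕ) → List Step
pathC m n = pathFrom m n (m ℕ.+ n) 0 0

downTo : ∀ {k} → Fin k → List (Fin k)
downTo zero = zero ∷ []
downTo (suc j) = map suc (downTo j) ++ (zero ∷ [])

prefixes : ∀ {A : Set} → List A → List (List A)
prefixes [] = [] ∷ []
prefixes (x ∷ xs) = [] ∷ map (x ∷_) (prefixes xs)

module _ {c ℓ} (A : Ring c ℓ) where
  open Ring A using (Carrier; _≈_; _+_; _*_; _-_; 0#; 1#)

  infixr 8 _^'_
  _^'_ : Carrier → ℕ → Carrier
  x ^' zero = 1#
  x ^' suc n = x * (x ^' n)

  prodC : List Carrier → Carrier
  prodC = foldr _*_ 1#

  sumC : List Carrier → Carrier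
  sumC = foldr _+_ 0#

  -- Σ_{w ∈ S_{k+1}} u^{ℓ(w)} = ∏_{j=1}^{k} (1 + u + ⋯ + u^j)
  poincare : Carrier → ℕ → Carrier
  poincare u k = prodC (map (λ (j : Fin k) → sumC (map (λ i → u ^' toℕ i) (allFin (suc (suc (toℕ j)))))) (allFin k))

  -- A ring containing elements satisfying the defining relations of the
  -- DAHA  𝐇̈_{N;q,t}, N = suc k, with central invertible scalars
  -- q^{1/2}, t^{1/2}, and Σ_w t^{-ℓ(w)} invertible.
  record DAHA (k : ℕ) : Set (c ⊔ ℓ) where
    field
      qh qhi th thi pinv : Carrier
      Xg Xig Yg Yig : Fin (suc k) → Carrier
      Tg Tig : Fin k → Carrier
      qh-inv   : qh * qhi ≈ 1#
      qh-inv'  : qhi * qh ≈ 1#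
      th-inv   : th * thi ≈ 1#
      th-inv'  : thi * th ≈ 1#
      pinv-inv  : pinv * poincare (thi * thi) k ≈ 1#
      pinv-inv' : poincare (thi * thi) k * pinv ≈ 1#
      qh-central   : ∀ x → qh * x ≈ x * qh
      qhi-central  : ∀ x → qhi * x ≈ x * qhi
      th-central   : ∀ x → th * x ≈ x * th
      thi-central  : ∀ x → thi * x ≈ x * thi
      pinv-central : ∀ x → pinv * x ≈ x * pinv
      X-inv  : ∀ i → Xg i * Xig i ≈ 1#
      X-inv' : ∀ i → Xig i * Xg i ≈ 1#
      Y-inv  : ∀ i → Yg i * Yig i ≈ 1#
      Y-inv' : ∀ i → Yig i * Yg i ≈ 1#
      T-inv  : ∀ i → Tg i * Tig i ≈ 1#
      T-inv' : ∀ i → Tig i * Tg i ≈ 1#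
      T-quad : ∀ i → (Tg i + th) * (Tg i - thi) ≈ 0#
      T-braid : ∀ i j → toℕ j ≡ suc (toℕ i) → Tg i * Tg j * Tg i ≈ Tg j * Tg i * Tg j
      T-comm  : ∀ i j → Far (toℕ i) (toℕ j) → Tg i * Tg j ≈ Tg j * Tg i
      X-comm : ∀ i j → Xg i * Xg j ≈ Xg j * Xg i
      Y-comm : ∀ i j → Yg i * Yg j ≈ Yg j * Yg i
      TXT : ∀ i → Tg i * Xg (inject₁ i) * Tg i ≈ Xg (suc i)
      TYT : ∀ i → Tig i * Yg (inject₁ i) * Tig i ≈ Yg (suc i)
      TX-comm : ∀ i j → Far (toℕ i) (toℕ j) → Tg i * Xg j ≈ Xg j * Tg i
      TY-comm : ∀ i j → Far (toℕ i) (toℕ j) → Tg i * Yg j ≈ Yg j * Tg i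
      YX-q : Yg zero * prodC (map Xg (allFin (suc k)))
             ≈ (qh * qh) * prodC (map Xg (allFin (suc k))) * Yg zero
      -- X_1^{-1} Y_2 = Y_2 X_1^{-1} T_1^{-2}   (only when N ≥ 2)
      XY-rel : ∀ (i : Fin k) → toℕ i ≡ 0 →
               Xig (inject₁ i) * Yg (suc i) ≈ Yg (suc i) * Xig (inject₁ i) * (Tig i * Tig i)

  module _ {k : ℕ} (H : DAHA k) where
    open DAHA H

    evalL : Letter k → Carrier
    evalL (X i)  = Xg i
    evalL (X⁻ i) = Xig i
    evalL (Y i)  = Yg i
    evalL (Y⁻ i) = Yig i
    evalL (T i)  = Tg i
    evalL (T⁻ i) = Tig i

    eval : Term Carrier k → Carrier
    eval (lit s) = s
    eval (gen l) = evalL l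
    eval zro = 0#
    eval one = 1#
    eval (t ⊕ u) = eval t + eval u
    eval (t ⊗ u) = eval t * eval u

    -- Σ_{w ∈ S_N} t^{-ℓ(w)/2} T_w, written via the factorisation
    -- S_N = S_1 · R_1 ⋯ R_{N-1}, R_j = {1, s_j, s_j s_{j-1}, …, s_j ⋯ s_1}
    -- (lengths add, so T_w = T_{r_1} ⋯ T_{r_{N-1}}).
    symT : Term Carrier k
    symT = prodT (map (λ j → sumT (map (λ ch → lit (thi ^' length ch) ⊗ word (map T ch))
                                        (prefixes (downTo j))))
                      (allFin k))

    eN : Term Carrier k
    eN = lit pinv ⊗ symT

    γN : Carrier
    γN = 1# - th ^' (2 ℕ.* suc k)

    D0 : ℕ → Term Carrier k
    D0 d = lit γN ⊗ eN ⊗ gen (Y zero) ⊗ powT (gen (X zero)) d ⊗ gen (Y⁻ zero) ⊗ eN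

    stepT : Step → Term Carrier k
    stepT up    = gen (Y zero)
    stepT right = gen (Y zero) ⊗ gen (X zero) ⊗ gen (Y⁻ zero)

    Dmn : ℕ → ℕ → Term Carrier k
    Dmn m n = lit γN ⊗ eN ⊗ prodT (map stepT (pathC m n)) ⊗ eN

-- On X₁ and Y₁ the two generators act without any T: τ₊ fixes X₁ and sends Y₁ to Y₁X₁,
-- τ₋ fixes Y₁ and sends X₁ to X₁Y₁, and both fix every Tᵢ, hence e_N.  So it suffices to
-- compute g(Y₁X₁ᵈY₁⁻¹) in the free group on X₁, Y₁.  The step product of D_{a,b} equals
-- Y₁wY₁⁻¹, where w spells the lattice path with up ↦ Y₁ and right ↦ X₁.  On such words τ₋
-- and τ₊ act as the shears (x, y) ↦ (x, x + y) and (x, y) ↦ (x + y, y) of the path, and the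
-- highest path under the line to (a, a + b), resp. (a + b, b), is the shear of the highest
-- path under the line to (a, b).  Starting from the horizontal path to (d, 0), induction on g
-- gives g(Y₁X₁ᵈY₁⁻¹) = Y₁wY₁⁻¹ for the path to d times the first column of g.  Such g exist
-- by the subtractive Euclidean algorithm, which preserves the gcd.

module Submission where

open import Defs
open import Level using (Level)
open import Data.Nat as ℕ using (ℕ; _≤_; NonZero; ≢-nonZero; ≢-nonZero⁻¹; >-nonZero)
open import Data.Nat.GCD using (gcd; gcd[m,n]≢0)
open import Data.Integer using (+_)
open import Data.List using (List)
open import Data.Product using (Σ; _×_; _,_)
open import Data.Sum using (inj₁)
open import Relation.Binary.PropositionalEquality using (_≡_; subst₂)
open import Algebra.Bundles using (Ring)

module LatticePath where
  open import Data.Nat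
  open import Data.Nat.Properties
  open import Data.Bool.Properties using (∧-zeroʳ)
  open import Data.List using (List; []; _∷_; _++_; [_]; replicate)
  open import Data.Sum using (inj₁; inj₂)
  open import Data.Product using (_×_; _,_)
  open import Data.Empty using (⊥-elim)
  open import Function.Bundles using (_⇔_; mk⇔; Equivalence)
  open import Relation.Nullary using (¬_; does; yes; no)
  open import Relation.Nullary.Decidable using (dec-true; dec-false)
  open import Relation.Binary.PropositionalEquality hiding ([_])

  shearUp : List Step → List Step
  shearUp []          = []
  shearUp (up ∷ s)    = up ∷ shearUp s
  shearUp (right ∷ s) = right ∷ up ∷ shearUp s

  shearRight : List Step → List Step
  shearRight []          = []
  shearRight (up ∷ s)    = up ∷ right ∷ shearRight s
  shearRight (right ∷ s) = right ∷ shearRight s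

  pathFrom-up : ∀ m n f i j → suc j ≤ n → suc j * m ≤ i * n →
                pathFrom m n (suc f) i j ≡ up ∷ pathFrom m n f i (suc j)
  pathFrom-up m n f i j j<n below
    rewrite dec-true (suc j ≤? n) j<n | dec-true (suc j * m ≤? i * n) below = refl

  pathFrom-right : ∀ m n f i j → ¬ (suc j * m ≤ i * n) →
                   pathFrom m n (suc f) i j ≡ right ∷ pathFrom m n f (suc i) j
  pathFrom-right m n f i j above
    rewrite dec-false (suc j * m ≤? i * n) above | ∧-zeroʳ (does (suc j ≤? n)) = refl

  pathFrom-horizontal : ∀ m f i j → pathFrom m 0 f i j ≡ replicate f right
  pathFrom-horizontal m zero    i j = refl
  pathFrom-horizontal m (suc f) i j = cong (right ∷_) (pathFrom-horizontal m f (suc i) j)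

  pathC-horizontal : ∀ m → pathC m 0 ≡ replicate m right
  pathC-horizontal m = trans (pathFrom-horizontal m (m + 0) 0 0) (cong (λ l → replicate l right) (+-identityʳ m))

  shearᵛ-below : ∀ a b i j → (i + j) * a ≤ i * (a + b) ⇔ j * a ≤ i * b
  shearᵛ-below a b i j = mk⇔
    (λ h → +-cancelˡ-≤ (i * a) _ _ (subst₂ _≤_ (*-distribʳ-+ a i j) (*-distribˡ-+ i a b) h))
    (λ h → subst₂ _≤_ (sym (*-distribʳ-+ a i j)) (sym (*-distribˡ-+ i a b)) (+-monoʳ-≤ (i * a) h))

  shearʰ-below : ∀ a b i j → j * (a + b) ≤ (i + j) * b ⇔ j * a ≤ i * b
  shearʰ-below a b i j = mk⇔
    (λ h → +-cancelʳ-≤ (j * b) _ _ (subst₂ _≤_ (*-distribˡ-+ j a b) (*-distribʳ-+ b i j) h))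
    (λ h → subst₂ _≤_ (sym (*-distribˡ-+ j a b)) (sym (*-distribʳ-+ b i j)) (+-monoˡ-≤ (j * b) h))

  endpoint : ∀ {i j a b} → i ≤ a → j ≤ b → i + j ≡ a + b → i ≡ a × j ≡ b
  endpoint i≤a j≤b eq with m≤n⇒m<n∨m≡n i≤a
  ... | inj₂ refl = refl , +-cancelˡ-≡ _ _ _ eq
  ... | inj₁ i<a  = ⊥-elim (<-irrefl eq (+-mono-<-≤ i<a j≤b))

  fuel-before-step : ∀ f {i a} → suc i ≤ a → suc f + (a ∸ i) ≡ suc (suc (f + (a ∸ suc i)))
  fuel-before-step f i<a = trans (cong (_+_ (suc f)) (+-∸-assoc 1 i<a)) (cong suc (+-suc f _))

  module _ (a b : ℕ) .{{_ : NonZero a}} where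

    private
      P P′ P″ : ℕ → ℕ → ℕ → List Step
      P  = pathFrom a b
      P′ = pathFrom a (a + b)
      P″ = pathFrom (a + b) b

    up-within-height : ∀ i j → i ≤ a → suc j * a ≤ i * b → suc j ≤ b
    up-within-height i j i≤a below =
      *-cancelʳ-≤ (suc j) b a (≤-trans below (≤-trans (*-monoˡ-≤ b i≤a) (≤-reflexive (*-comm a b))))

    right-within-width : ∀ f i j → i ≤ a → ¬ (suc j * a ≤ i * b) → suc f + (i + j) ≡ a + b →
                         suc i ≤ a
    right-within-width f i j i≤a above fuel with m≤n⇒m<n∨m≡n i≤a
    ... | inj₁ i<a  = i<a
    ... | inj₂ refl = ⊥-elim (above (≤-trans (*-monoˡ-≤ a j<b) (≤-reflexive (*-comm b a))))
      where
      j<b : suc j ≤ b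
      j<b = +-cancelˡ-≤ a (suc j) b (subst (a + suc j ≤_) fuel
              (≤-trans (≤-reflexive (+-suc a j)) (s≤s (m≤n+m (a + j) f))))

    not-at-end : ∀ f i j → suc f + (i + j) ≡ a + b → suc (i + j) ≤ a + b
    not-at-end f i j fuel = subst (suc (i + j) ≤_) fuel (s≤s (m≤n+m (i + j) f))

    fuel-after-up : ∀ f i j → suc f + (i + j) ≡ a + b → f + (i + suc j) ≡ a + b
    fuel-after-up f i j fuel = trans (cong (_+_ f) (+-suc i j)) (trans (+-suc f (i + j)) fuel)

    fuel-after-right : ∀ f i j → suc f + (i + j) ≡ a + b → f + (suc i + j) ≡ a + b
    fuel-after-right f i j fuel = trans (+-suc f (i + j)) fuel

    -- The sheared walk takes an extra up step after each of the a ∸ i right steps still ahead.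
    pathFrom-shearᵛ : ∀ f i j → i ≤ a → j ≤ b → j * a ≤ i * b → f + (i + j) ≡ a + b →
                      P′ (f + (a ∸ i)) i (i + j) ≡ shearUp (P f i j)
    pathFrom-shearᵛ zero i j i≤a j≤b below fuel with endpoint i≤a j≤b fuel
    ... | refl , refl rewrite n∸n≡0 a = refl
    pathFrom-shearᵛ (suc f) i j i≤a j≤b below fuel with suc j * a ≤? i * b
    ... | yes goes-up = begin
        P′ (suc f + (a ∸ i)) i (i + j)
          ≡⟨ pathFrom-up a (a + b) (f + (a ∸ i)) i (i + j) (not-at-end f i j fuel) image-goes-up ⟩
        up ∷ P′ (f + (a ∸ i)) i (suc (i + j))
          ≡⟨ cong (λ h → up ∷ P′ (f + (a ∸ i)) i h) (sym (+-suc i j)) ⟩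
        up ∷ P′ (f + (a ∸ i)) i (i + suc j)
          ≡⟨ cong (up ∷_) (pathFrom-shearᵛ f i (suc j) i≤a j<b goes-up (fuel-after-up f i j fuel)) ⟩
        shearUp (up ∷ P f i (suc j))
          ≡⟨ cong shearUp (pathFrom-up a b f i j j<b goes-up) ⟨
        shearUp (P (suc f) i j) ∎
      where
      open ≡-Reasoning
      j<b : suc j ≤ b
      j<b = up-within-height i j i≤a goes-up
      image-goes-up : suc (i + j) * a ≤ i * (a + b)
      image-goes-up = subst (λ h → h * a ≤ i * (a + b)) (+-suc i j)
                            (Equivalence.from (shearᵛ-below a b i (suc j)) goes-up)
    ... | no goes-right = begin
        P′ (suc f + (a ∸ i)) i (i + j)
          ≡⟨ cong (λ f′ → P′ f′ i (i + j)) (fuel-before-step f i<a) ⟩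
        P′ (suc (suc (f + (a ∸ suc i)))) i (i + j)
          ≡⟨ pathFrom-right a (a + b) (suc (f + (a ∸ suc i))) i (i + j) image-goes-right ⟩
        right ∷ P′ (suc (f + (a ∸ suc i))) (suc i) (i + j)
          ≡⟨ cong (right ∷_) (pathFrom-up a (a + b) (f + (a ∸ suc i)) (suc i) (i + j)
                                          (not-at-end f i j fuel) image-then-up) ⟩
        right ∷ up ∷ P′ (f + (a ∸ suc i)) (suc i) (suc i + j)
          ≡⟨ cong (λ p → right ∷ up ∷ p)
                  (pathFrom-shearᵛ f (suc i) j i<a j≤b below′ (fuel-after-right f i j fuel)) ⟩
        shearUp (right ∷ P f (suc i) j)
          ≡⟨ cong shearUp (pathFrom-right a b f i j goes-right) ⟨
        shearUp (P (suc f) i j) ∎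
      where
      open ≡-Reasoning
      i<a : suc i ≤ a
      i<a = right-within-width f i j i≤a goes-right fuel
      below′ : j * a ≤ suc i * b
      below′ = ≤-trans below (*-monoˡ-≤ b (n≤1+n i))
      image-goes-right : ¬ (suc (i + j) * a ≤ i * (a + b))
      image-goes-right h = goes-right (Equivalence.to (shearᵛ-below a b i (suc j))
                             (subst (λ h′ → h′ * a ≤ i * (a + b)) (sym (+-suc i j)) h))
      image-then-up : suc (i + j) * a ≤ suc i * (a + b)
      image-then-up = Equivalence.from (shearᵛ-below a b (suc i) j) below′

    sheared-goes-right : ∀ i j → i * b < suc j * a + b → ¬ (suc j * (a + b) ≤ (i + j) * b)
    sheared-goes-right i j left-of h =
      <⇒≱ left-of (+-cancelʳ-≤ (j * b) _ _ (subst₂ _≤_ split (*-distribʳ-+ b i j) h))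
      where
      split : suc j * (a + b) ≡ (suc j * a + b) + j * b
      split = trans (*-distribˡ-+ (suc j) a b) (sym (+-assoc (suc j * a) b (j * b)))

    -- The invariant i * b < suc j * a + b holds at every vertex of the greedy walk: it records
    -- that the last right step was forced.
    pathFrom-shearʰ : ∀ f i j → i ≤ a → j ≤ b → i * b < suc j * a + b → f + (i + j) ≡ a + b →
                      right ∷ shearRight (P f i j) ≡ P″ (f + (b ∸ j)) (i + j) j ++ [ right ]
    pathFrom-shearʰ zero i j i≤a j≤b left-of fuel with endpoint i≤a j≤b fuel
    ... | refl , refl rewrite n∸n≡0 b = refl
    pathFrom-shearʰ (suc f) i j i≤a j≤b left-of fuel with suc j * a ≤? i * b
    ... | yes goes-up = begin
        right ∷ shearRight (P (suc f) i j)
          ≡⟨ cong (λ p → right ∷ shearRight p) (pathFrom-up a b f i j j<b goes-up) ⟩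
        right ∷ up ∷ right ∷ shearRight (P f i (suc j))
          ≡⟨ cong (λ p → right ∷ up ∷ p)
                  (pathFrom-shearʰ f i (suc j) i≤a j<b left-of′ (fuel-after-up f i j fuel)) ⟩
        right ∷ up ∷ (P″ (f + (b ∸ suc j)) (i + suc j) (suc j) ++ [ right ])
          ≡⟨ cong (λ h → right ∷ up ∷ (P″ (f + (b ∸ suc j)) h (suc j) ++ [ right ])) (+-suc i j) ⟩
        right ∷ up ∷ (P″ (f + (b ∸ suc j)) (suc (i + j)) (suc j) ++ [ right ])
          ≡⟨ cong (λ p → right ∷ (p ++ [ right ]))
                  (pathFrom-up (a + b) b (f + (b ∸ suc j)) (suc (i + j)) j j<b image-goes-up) ⟨
        right ∷ (P″ (suc (f + (b ∸ suc j))) (suc (i + j)) j ++ [ right ])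
          ≡⟨ cong (_++ [ right ]) (pathFrom-right (a + b) b (suc (f + (b ∸ suc j))) (i + j) j
                                                 (sheared-goes-right i j left-of)) ⟨
        P″ (suc (suc (f + (b ∸ suc j)))) (i + j) j ++ [ right ]
          ≡⟨ cong (λ f′ → P″ f′ (i + j) j ++ [ right ]) (fuel-before-step f j<b) ⟨
        P″ (suc f + (b ∸ j)) (i + j) j ++ [ right ] ∎
      where
      open ≡-Reasoning
      j<b : suc j ≤ b
      j<b = up-within-height i j i≤a goes-up
      left-of′ : i * b < suc (suc j) * a + b
      left-of′ = <-≤-trans left-of (+-monoˡ-≤ b (*-monoˡ-≤ a (n≤1+n (suc j))))
      image-goes-up : suc j * (a + b) ≤ suc (i + j) * b
      image-goes-up = subst (λ h → suc j * (a + b) ≤ h * b) (+-suc i j)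
                            (Equivalence.from (shearʰ-below a b i (suc j)) goes-up)
    ... | no goes-right = begin
        right ∷ shearRight (P (suc f) i j)
          ≡⟨ cong (λ p → right ∷ shearRight p) (pathFrom-right a b f i j goes-right) ⟩
        right ∷ right ∷ shearRight (P f (suc i) j)
          ≡⟨ cong (right ∷_)
                  (pathFrom-shearʰ f (suc i) j i<a j≤b left-of′ (fuel-after-right f i j fuel)) ⟩
        right ∷ (P″ (f + (b ∸ j)) (suc i + j) j ++ [ right ])
          ≡⟨ cong (_++ [ right ]) (pathFrom-right (a + b) b (f + (b ∸ j)) (i + j) j
                                                 (sheared-goes-right i j left-of)) ⟨
        P″ (suc f + (b ∸ j)) (i + j) j ++ [ right ] ∎
      where
      open ≡-Reasoning
      i<a : suc i ≤ a
      i<a = right-within-width f i j i≤a goes-right fuel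
      left-of′ : suc i * b < suc j * a + b
      left-of′ = subst (suc i * b <_) (+-comm b (suc j * a)) (+-monoʳ-< b (≰⇒> goes-right))

    pathC-shearᵛ : pathC a (a + b) ≡ shearUp (pathC a b)
    pathC-shearᵛ = trans (cong (λ f → P′ f 0 0) (+-comm a (a + b)))
                         (pathFrom-shearᵛ (a + b) 0 0 z≤n z≤n z≤n (+-identityʳ (a + b)))

    pathC-shearʰ : right ∷ shearRight (pathC a b) ≡ pathC (a + b) b ++ [ right ]
    pathC-shearʰ = pathFrom-shearʰ (a + b) 0 0 z≤n z≤n origin-left-of (+-identityʳ (a + b))
      where
      origin-left-of : 0 * b < 1 * a + b
      origin-left-of = ≤-trans (>-nonZero⁻¹ a) (≤-trans (m≤m+n a 0) (m≤m+n (1 * a) b))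

open LatticePath

module FirstColumn where
  open import Data.Nat using (ℕ; suc; _+_; _*_; NonZero)
  open import Data.Nat.Properties using (*-comm; m*n≢0)
  open import Data.Integer as ℤ using (+_)
  import Data.Integer.Properties as ℤ
  open import Data.List using (List; []; _∷_)
  open import Data.Product using (_×_; _,_)
  open import Relation.Binary.PropositionalEquality

  col₁ col₂ : List BG → ℕ
  col₁ []       = 1
  col₁ (τ₊ ∷ g) = col₁ g + col₂ g
  col₁ (τ₋ ∷ g) = col₁ g
  col₂ []       = 0
  col₂ (τ₊ ∷ g) = col₂ g
  col₂ (τ₋ ∷ g) = col₁ g + col₂ g

  col₁-nonZero : ∀ g → NonZero (col₁ g)
  col₁-nonZero []       = _
  col₁-nonZero (τ₊ ∷ g) with col₁ g | col₁-nonZero g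
  ... | suc _ | _ = _
  col₁-nonZero (τ₋ ∷ g) = col₁-nonZero g

  scaled-col₁-nonZero : ∀ d g .{{_ : NonZero d}} → NonZero (d * col₁ g)
  scaled-col₁-nonZero (suc d) g = m*n≢0 (suc d) (col₁ g) {{_}} {{col₁-nonZero g}}

  matOf-firstColumn : ∀ g → Mat2.a (matOf g) ≡ + col₁ g × Mat2.c (matOf g) ≡ + col₂ g
  matOf-firstColumn [] = refl , refl
  matOf-firstColumn (τ₊ ∷ g) with matOf g | matOf-firstColumn g
  ... | mat _ _ _ _ | refl , refl =
    trans (cong₂ ℤ._+_ (ℤ.*-identityˡ (+ col₁ g)) (ℤ.*-identityˡ (+ col₂ g)))
          (sym (ℤ.pos-+ (col₁ g) (col₂ g))) ,
    trans (ℤ.+-identityˡ _) (ℤ.*-identityˡ (+ col₂ g))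
  matOf-firstColumn (τ₋ ∷ g) with matOf g | matOf-firstColumn g
  ... | mat _ _ _ _ | refl , refl =
    trans (cong (ℤ._+ ℤ.0ℤ) (ℤ.*-identityˡ (+ col₁ g))) (ℤ.+-identityʳ (+ col₁ g)) ,
    trans (cong₂ ℤ._+_ (ℤ.*-identityˡ (+ col₁ g)) (ℤ.*-identityˡ (+ col₂ g)))
          (sym (ℤ.pos-+ (col₁ g) (col₂ g)))

  matOf-▷ : ∀ g d → matOf g ▷ (+ d , + 0) ≡ (+ (d * col₁ g) , + (d * col₂ g))
  matOf-▷ g d with matOf g | matOf-firstColumn g
  ... | mat _ b _ e | refl , refl = cong₂ _,_ (scaled (col₁ g) b) (scaled (col₂ g) e)
    where
    scaled : ∀ p z → (+ p ℤ.* + d) ℤ.+ z ℤ.* + 0 ≡ + (d * p)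
    scaled p z = trans (cong (ℤ._+_ (+ p ℤ.* + d)) (ℤ.*-zeroʳ z))
                (trans (ℤ.+-identityʳ _) (trans (sym (ℤ.pos-* p d)) (cong +_ (*-comm p d))))

  ▷-firstColumn : ∀ g d {m n} → matOf g ▷ (+ d , + 0) ≡ (+ m , + n) →
                  d * col₁ g ≡ m × d * col₂ g ≡ n
  ▷-firstColumn g d eq with trans (sym (matOf-▷ g d)) eq
  ... | refl = refl , refl

open FirstColumn

module FreeWords where
  open import Data.Nat using (ℕ; _+_; _*_; NonZero)
  open import Data.Nat.Properties using (*-identityʳ; *-zeroʳ; *-distribˡ-+)
  open import Data.List using (List; []; _∷_; _++_; [_]; map; replicate; concatMap)
  open import Data.List.Properties using (++-assoc; map-++; concatMap-++; map-replicate)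
  open import Relation.Binary.Construct.Closure.ReflexiveTransitive using (Star; ε; _◅_; gmap; kleisliStar)
  open import Relation.Binary.Construct.Closure.ReflexiveTransitive.Properties using (module StarReasoning)
  open import Relation.Binary.PropositionalEquality hiding ([_])

  data FreeLetter : Set where
    x x⁻ y y⁻ : FreeLetter

  inverse : FreeLetter → FreeLetter
  inverse x  = x⁻
  inverse x⁻ = x
  inverse y  = y⁻
  inverse y⁻ = y

  infix 4 _⇝_ _⇝*_

  data _⇝_ : List FreeLetter → List FreeLetter → Set where
    cancel : ∀ u l v → u ++ l ∷ inverse l ∷ v ⇝ u ++ v

  _⇝*_ : List FreeLetter → List FreeLetter → Set
  _⇝*_ = Star _⇝_

  ⇝-prefix : ∀ p {u v} → u ⇝ v → p ++ u ⇝ p ++ v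
  ⇝-prefix p (cancel u l v) =
    subst₂ _⇝_ (++-assoc p u (l ∷ inverse l ∷ v)) (++-assoc p u v) (cancel (p ++ u) l v)

  ⇝*-prefix : ∀ p {u v} → u ⇝* v → p ++ u ⇝* p ++ v
  ⇝*-prefix p = gmap (p ++_) (⇝-prefix p)

  cancel-pair : ∀ l₁ l₂ w → l₁ ∷ l₂ ∷ inverse l₂ ∷ inverse l₁ ∷ w ⇝* w
  cancel-pair l₁ l₂ w = cancel [ l₁ ] l₂ (inverse l₁ ∷ w) ◅ cancel [] l₁ w ◅ ε

  -- actLetter on X₁^{±1}, Y₁^{±1}: the T-chains below zero are empty.
  braidLetter : BG → FreeLetter → List FreeLetter
  braidLetter τ₊ x  = [ x ]
  braidLetter τ₊ x⁻ = [ x⁻ ]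
  braidLetter τ₊ y  = y ∷ x ∷ []
  braidLetter τ₊ y⁻ = x⁻ ∷ y⁻ ∷ []
  braidLetter τ₋ x  = x ∷ y ∷ []
  braidLetter τ₋ x⁻ = y⁻ ∷ x⁻ ∷ []
  braidLetter τ₋ y  = [ y ]
  braidLetter τ₋ y⁻ = [ y⁻ ]

  braidLetter-inverse : ∀ b l w → braidLetter b l ++ braidLetter b (inverse l) ++ w ⇝* w
  braidLetter-inverse τ₊ x  w = cancel [] x w ◅ ε
  braidLetter-inverse τ₊ x⁻ w = cancel [] x⁻ w ◅ ε
  braidLetter-inverse τ₊ y  w = cancel-pair y x w
  braidLetter-inverse τ₊ y⁻ w = cancel-pair x⁻ y⁻ w
  braidLetter-inverse τ₋ x  w = cancel-pair x y w
  braidLetter-inverse τ₋ x⁻ w = cancel-pair y⁻ x⁻ w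
  braidLetter-inverse τ₋ y  w = cancel [] y w ◅ ε
  braidLetter-inverse τ₋ y⁻ w = cancel [] y⁻ w ◅ ε

  substitute : BG → List FreeLetter → List FreeLetter
  substitute b = concatMap (braidLetter b)

  substitute-⇝ : ∀ b {u v} → u ⇝ v → substitute b u ⇝* substitute b v
  substitute-⇝ b (cancel u l v) = begin
      substitute b (u ++ l ∷ inverse l ∷ v)
    ≡⟨ concatMap-++ (braidLetter b) u (l ∷ inverse l ∷ v) ⟩
      substitute b u ++ braidLetter b l ++ braidLetter b (inverse l) ++ substitute b v
    ⟶*⟨ ⇝*-prefix (substitute b u) (braidLetter-inverse b l (substitute b v)) ⟩
      substitute b u ++ substitute b v
    ≡⟨ concatMap-++ (braidLetter b) u v ⟨
      substitute b (u ++ v) ∎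
    where open StarReasoning _⇝_

  substitute-⇝* : ∀ b {u v} → u ⇝* v → substitute b u ⇝* substitute b v
  substitute-⇝* b = kleisliStar (substitute b) (substitute-⇝ b)

  braidImage : List BG → List FreeLetter → List FreeLetter
  braidImage []      w = w
  braidImage (b ∷ g) w = substitute b (braidImage g w)

  stepLetter : Step → FreeLetter
  stepLetter up    = y
  stepLetter right = x

  -- Each right step of D_{a,b} is the conjugate Y₁X₁Y₁⁻¹, so its step product telescopes to this word.
  pathWord : ℕ → ℕ → List FreeLetter
  pathWord a b = y ∷ map stepLetter (pathC a b) ++ [ y⁻ ]

  substitute-τ₋-steps : ∀ s → substitute τ₋ (map stepLetter s) ≡ map stepLetter (shearUp s)
  substitute-τ₋-steps []          = refl
  substitute-τ₋-steps (up ∷ s)    = cong (y ∷_) (substitute-τ₋-steps s)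
  substitute-τ₋-steps (right ∷ s) = cong (λ w → x ∷ y ∷ w) (substitute-τ₋-steps s)

  substitute-τ₊-steps : ∀ s → substitute τ₊ (map stepLetter s) ≡ map stepLetter (shearRight s)
  substitute-τ₊-steps []          = refl
  substitute-τ₊-steps (up ∷ s)    = cong (λ w → y ∷ x ∷ w) (substitute-τ₊-steps s)
  substitute-τ₊-steps (right ∷ s) = cong (x ∷_) (substitute-τ₊-steps s)

  substitute-τ₋-pathWord : ∀ a b .{{_ : NonZero a}} → substitute τ₋ (pathWord a b) ≡ pathWord a (a + b)
  substitute-τ₋-pathWord a b = begin
    y ∷ substitute τ₋ (map stepLetter (pathC a b) ++ [ y⁻ ])
      ≡⟨ cong (y ∷_) (concatMap-++ (braidLetter τ₋) (map stepLetter (pathC a b)) [ y⁻ ]) ⟩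
    y ∷ substitute τ₋ (map stepLetter (pathC a b)) ++ [ y⁻ ]
      ≡⟨ cong (λ w → y ∷ w ++ [ y⁻ ]) (substitute-τ₋-steps (pathC a b)) ⟩
    y ∷ map stepLetter (shearUp (pathC a b)) ++ [ y⁻ ]
      ≡⟨ cong (λ s → y ∷ map stepLetter s ++ [ y⁻ ]) (sym (pathC-shearᵛ a b)) ⟩
    pathWord a (a + b) ∎
    where open ≡-Reasoning

  substitute-τ₊-pathWord : ∀ a b .{{_ : NonZero a}} → substitute τ₊ (pathWord a b) ⇝* pathWord (a + b) b
  substitute-τ₊-pathWord a b = begin
    y ∷ x ∷ substitute τ₊ (map stepLetter (pathC a b) ++ [ y⁻ ])
      ≡⟨ cong (λ w → y ∷ x ∷ w) (concatMap-++ (braidLetter τ₊) (map stepLetter (pathC a b)) [ y⁻ ]) ⟩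
    y ∷ x ∷ substitute τ₊ (map stepLetter (pathC a b)) ++ x⁻ ∷ y⁻ ∷ []
      ≡⟨ cong (λ w → y ∷ x ∷ w ++ x⁻ ∷ y⁻ ∷ []) (substitute-τ₊-steps (pathC a b)) ⟩
    y ∷ map stepLetter (right ∷ shearRight (pathC a b)) ++ x⁻ ∷ y⁻ ∷ []
      ≡⟨ cong (λ s → y ∷ map stepLetter s ++ x⁻ ∷ y⁻ ∷ []) (pathC-shearʰ a b) ⟩
    y ∷ map stepLetter (pathC (a + b) b ++ [ right ]) ++ x⁻ ∷ y⁻ ∷ []
      ≡⟨ cong (λ w → y ∷ w ++ x⁻ ∷ y⁻ ∷ []) (map-++ stepLetter (pathC (a + b) b) [ right ]) ⟩
    y ∷ (map stepLetter (pathC (a + b) b) ++ [ x ]) ++ x⁻ ∷ y⁻ ∷ []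
      ≡⟨ cong (y ∷_) (++-assoc (map stepLetter (pathC (a + b) b)) [ x ] (x⁻ ∷ y⁻ ∷ [])) ⟩
    (y ∷ map stepLetter (pathC (a + b) b)) ++ x ∷ x⁻ ∷ [ y⁻ ]
      ⟶⟨ cancel (y ∷ map stepLetter (pathC (a + b) b)) x [ y⁻ ] ⟩
    pathWord (a + b) b ∎
    where open StarReasoning _⇝_

  braidImage-conjugatePower : ∀ g d .{{_ : NonZero d}} →
    braidImage g (y ∷ replicate d x ++ [ y⁻ ]) ⇝* pathWord (d * col₁ g) (d * col₂ g)
  braidImage-conjugatePower [] d
    rewrite *-identityʳ d | *-zeroʳ d | pathC-horizontal d | map-replicate stepLetter d right = ε
  braidImage-conjugatePower (τ₋ ∷ g) d = begin
    substitute τ₋ (braidImage g (y ∷ replicate d x ++ [ y⁻ ]))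
      ⟶*⟨ substitute-⇝* τ₋ (braidImage-conjugatePower g d) ⟩
    substitute τ₋ (pathWord (d * col₁ g) (d * col₂ g))
      ≡⟨ substitute-τ₋-pathWord (d * col₁ g) (d * col₂ g) {{scaled-col₁-nonZero d g}} ⟩
    pathWord (d * col₁ g) (d * col₁ g + d * col₂ g)
      ≡⟨ cong (pathWord (d * col₁ g)) (sym (*-distribˡ-+ d (col₁ g) (col₂ g))) ⟩
    pathWord (d * col₁ g) (d * (col₁ g + col₂ g)) ∎
    where open StarReasoning _⇝_
  braidImage-conjugatePower (τ₊ ∷ g) d = begin
    substitute τ₊ (braidImage g (y ∷ replicate d x ++ [ y⁻ ]))
      ⟶*⟨ substitute-⇝* τ₊ (braidImage-conjugatePower g d) ⟩
    substitute τ₊ (pathWord (d * col₁ g) (d * col₂ g))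
      ⟶*⟨ substitute-τ₊-pathWord (d * col₁ g) (d * col₂ g) {{scaled-col₁-nonZero d g}} ⟩
    pathWord (d * col₁ g + d * col₂ g) (d * col₂ g)
      ≡⟨ cong (λ a → pathWord a (d * col₂ g)) (sym (*-distribˡ-+ d (col₁ g) (col₂ g))) ⟩
    pathWord (d * (col₁ g + col₂ g)) (d * col₂ g) ∎
    where open StarReasoning _⇝_

open FreeWords

module Evaluation {c ℓ} (A : Ring c ℓ) {k : ℕ} (H : DAHA A k) where
  open import Data.Nat using (NonZero) renaming (_*_ to _*ℕ_)
  open import Data.Fin using (zero)
  open import Data.Unit using (⊤)
  open import Data.Empty using (⊥)
  open import Data.Product using (_×_; _,_)
  open import Data.List using (List; []; _∷_; _++_; [_]; map; replicate; allFin)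
  open import Data.List.Relation.Unary.All using (All; []; _∷_; universal)
  open import Data.List.Relation.Unary.All.Properties using (map⁺)
  open import Relation.Binary.Construct.Closure.ReflexiveTransitive using (ε; _◅_)
  import Relation.Binary.PropositionalEquality as ≡
  open Ring A hiding (zero)
  open DAHA H
  open import Relation.Binary.Reasoning.Setoid setoid

  Valuation : Set c
  Valuation = Letter k → Carrier

  evalWith : Valuation → Term Carrier k → Carrier
  evalWith ρ (lit s) = s
  evalWith ρ (gen l) = ρ l
  evalWith ρ zro     = 0#
  evalWith ρ one     = 1#
  evalWith ρ (t ⊕ u) = evalWith ρ t + evalWith ρ u
  evalWith ρ (t ⊗ u) = evalWith ρ t * evalWith ρ u

  ρH : Valuation
  ρH = evalL A H

  eval-evalWith : ∀ t → eval A H t ≡.≡ evalWith ρH t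
  eval-evalWith (lit s) = ≡.refl
  eval-evalWith (gen l) = ≡.refl
  eval-evalWith zro     = ≡.refl
  eval-evalWith one     = ≡.refl
  eval-evalWith (t ⊕ u) = ≡.cong₂ _+_ (eval-evalWith t) (eval-evalWith u)
  eval-evalWith (t ⊗ u) = ≡.cong₂ _*_ (eval-evalWith t) (eval-evalWith u)

  _▸_ : BG → Valuation → Valuation
  (b ▸ ρ) l = evalWith ρ (word (actLetter b l))

  evalWith-actB : ∀ ρ b t → evalWith ρ (actB b t) ≡.≡ evalWith (b ▸ ρ) t
  evalWith-actB ρ b (lit s) = ≡.refl
  evalWith-actB ρ b (gen l) = ≡.refl
  evalWith-actB ρ b zro     = ≡.refl
  evalWith-actB ρ b one     = ≡.refl
  evalWith-actB ρ b (t ⊕ u) = ≡.cong₂ _+_ (evalWith-actB ρ b t) (evalWith-actB ρ b u)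
  evalWith-actB ρ b (t ⊗ u) = ≡.cong₂ _*_ (evalWith-actB ρ b t) (evalWith-actB ρ b u)

  actValuation : List BG → Valuation → Valuation
  actValuation []      ρ = ρ
  actValuation (b ∷ g) ρ = actValuation g (b ▸ ρ)

  evalWith-act : ∀ g ρ t → evalWith ρ (act g t) ≡.≡ evalWith (actValuation g ρ) t
  evalWith-act []      ρ t = ≡.refl
  evalWith-act (b ∷ g) ρ t = ≡.trans (evalWith-actB ρ b (act g t)) (evalWith-act g (b ▸ ρ) t)

  ι : FreeLetter → Letter k
  ι x  = X zero
  ι x⁻ = X⁻ zero
  ι y  = Y zero
  ι y⁻ = Y⁻ zero

  value : Valuation → List FreeLetter → Carrier
  value ρ []      = 1#
  value ρ (l ∷ w) = ρ (ι l) * value ρ w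

  value-++ : ∀ ρ u v → value ρ (u ++ v) ≈ value ρ u * value ρ v
  value-++ ρ []      v = sym (*-identityˡ _)
  value-++ ρ (l ∷ u) v = trans (*-congˡ (value-++ ρ u v)) (sym (*-assoc _ _ _))

  evalWith-word : ∀ ρ w → evalWith ρ (word (map ι w)) ≡.≡ value ρ w
  evalWith-word ρ []      = ≡.refl
  evalWith-word ρ (l ∷ w) = ≡.cong (ρ (ι l) *_) (evalWith-word ρ w)

  actLetter-ι : ∀ b l → actLetter b (ι l) ≡.≡ map ι (braidLetter b l)
  actLetter-ι τ₊ x  = ≡.refl
  actLetter-ι τ₊ x⁻ = ≡.refl
  actLetter-ι τ₊ y  = ≡.refl
  actLetter-ι τ₊ y⁻ = ≡.refl
  actLetter-ι τ₋ x  = ≡.refl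
  actLetter-ι τ₋ x⁻ = ≡.refl
  actLetter-ι τ₋ y  = ≡.refl
  actLetter-ι τ₋ y⁻ = ≡.refl

  ▸-ι : ∀ ρ b l → (b ▸ ρ) (ι l) ≡.≡ value ρ (braidLetter b l)
  ▸-ι ρ b l = ≡.trans (≡.cong (λ v → evalWith ρ (word v)) (actLetter-ι b l)) (evalWith-word ρ (braidLetter b l))

  value-substitute : ∀ ρ b w → value (b ▸ ρ) w ≈ value ρ (substitute b w)
  value-substitute ρ b []      = refl
  value-substitute ρ b (l ∷ w) = begin
    (b ▸ ρ) (ι l) * value (b ▸ ρ) w
      ≡⟨ ≡.cong (_* value (b ▸ ρ) w) (▸-ι ρ b l) ⟩
    value ρ (braidLetter b l) * value (b ▸ ρ) w
      ≈⟨ *-congˡ (value-substitute ρ b w) ⟩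
    value ρ (braidLetter b l) * value ρ (substitute b w)
      ≈⟨ value-++ ρ (braidLetter b l) (substitute b w) ⟨
    value ρ (substitute b (l ∷ w)) ∎

  value-braidImage : ∀ g ρ w → value (actValuation g ρ) w ≈ value ρ (braidImage g w)
  value-braidImage []      ρ w = refl
  value-braidImage (b ∷ g) ρ w = trans (value-braidImage g (b ▸ ρ) w) (value-substitute ρ b (braidImage g w))

  InverseRespecting : Valuation → Set ℓ
  InverseRespecting ρ = ∀ l → ρ (ι l) * ρ (ι (inverse l)) ≈ 1#

  value-⇝ : ∀ {ρ u v} → InverseRespecting ρ → u ⇝ v → value ρ u ≈ value ρ v
  value-⇝ {ρ} inv (cancel u l v) = begin
    value ρ (u ++ l ∷ inverse l ∷ v)                      ≈⟨ value-++ ρ u _ ⟩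
    value ρ u * (ρ (ι l) * (ρ (ι (inverse l)) * value ρ v)) ≈⟨ *-congˡ (*-assoc _ _ _) ⟨
    value ρ u * (ρ (ι l) * ρ (ι (inverse l)) * value ρ v)   ≈⟨ *-congˡ (*-congʳ (inv l)) ⟩
    value ρ u * (1# * value ρ v)                          ≈⟨ *-congˡ (*-identityˡ _) ⟩
    value ρ u * value ρ v                                 ≈⟨ value-++ ρ u v ⟨
    value ρ (u ++ v) ∎

  value-⇝* : ∀ {ρ u v} → InverseRespecting ρ → u ⇝* v → value ρ u ≈ value ρ v
  value-⇝* inv ε              = refl
  value-⇝* inv (step ◅ steps) = trans (value-⇝ inv step) (value-⇝* inv steps)

  AllLetters : (Letter k → Set) → Term Carrier k → Set
  AllLetters P (lit _) = ⊤
  AllLetters P (gen l) = P l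
  AllLetters P zro     = ⊤
  AllLetters P one     = ⊤
  AllLetters P (t ⊕ u) = AllLetters P t × AllLetters P u
  AllLetters P (t ⊗ u) = AllLetters P t × AllLetters P u

  evalWith-congOn : ∀ {P} ρ ρ′ → (∀ {l} → P l → ρ l ≈ ρ′ l) →
                    ∀ t → AllLetters P t → evalWith ρ t ≈ evalWith ρ′ t
  evalWith-congOn ρ ρ′ agree (lit s) _         = refl
  evalWith-congOn ρ ρ′ agree (gen l) p         = agree p
  evalWith-congOn ρ ρ′ agree zro     _         = refl
  evalWith-congOn ρ ρ′ agree one     _         = refl
  evalWith-congOn ρ ρ′ agree (t ⊕ u) (pt , pu) =
    +-cong (evalWith-congOn ρ ρ′ agree t pt) (evalWith-congOn ρ ρ′ agree u pu)
  evalWith-congOn ρ ρ′ agree (t ⊗ u) (pt , pu) =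
    *-cong (evalWith-congOn ρ ρ′ agree t pt) (evalWith-congOn ρ ρ′ agree u pu)

  AllLetters-word : ∀ {P w} → All P w → AllLetters P (word w)
  AllLetters-word []       = _
  AllLetters-word (p ∷ ps) = p , AllLetters-word ps

  AllLetters-sumT : ∀ {P} {B : Set} (h : B → Term Carrier k) xs →
                    (∀ a → AllLetters P (h a)) → AllLetters P (sumT (map h xs))
  AllLetters-sumT h []       ph = _
  AllLetters-sumT h (a ∷ xs) ph = ph a , AllLetters-sumT h xs ph

  AllLetters-prodT : ∀ {P} {B : Set} (h : B → Term Carrier k) xs →
                     (∀ a → AllLetters P (h a)) → AllLetters P (prodT (map h xs))
  AllLetters-prodT h []       ph = _
  AllLetters-prodT h (a ∷ xs) ph = ph a , AllLetters-prodT h xs ph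

  IsT : Letter k → Set
  IsT (T _) = ⊤
  IsT _     = ⊥

  eN-onlyT : AllLetters IsT (eN A H)
  eN-onlyT = _ , AllLetters-prodT _ (allFin k) (λ j → AllLetters-sumT _ (prefixes (downTo j))
                   (λ ch → _ , AllLetters-word (map⁺ (universal _ ch))))

  actValuation-fixesT : ∀ g ρ {l} → IsT l → actValuation g ρ l ≈ ρ l
  actValuation-fixesT []       ρ       _ = refl
  actValuation-fixesT (τ₊ ∷ g) ρ {T i} t = trans (actValuation-fixesT g (τ₊ ▸ ρ) t) (*-identityʳ _)
  actValuation-fixesT (τ₋ ∷ g) ρ {T i} t = trans (actValuation-fixesT g (τ₋ ▸ ρ) t) (*-identityʳ _)

  eN-invariant : ∀ g → evalWith (actValuation g ρH) (eN A H) ≈ evalWith ρH (eN A H)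
  eN-invariant g = evalWith-congOn _ _ (actValuation-fixesT g ρH) (eN A H) eN-onlyT

  evalWith-power : ∀ ρ l d → evalWith ρ (powT (gen (ι l)) d) ≡.≡ value ρ (replicate d l)
  evalWith-power ρ l ℕ.zero    = ≡.refl
  evalWith-power ρ l (ℕ.suc d) = ≡.cong (ρ (ι l) *_) (evalWith-power ρ l d)

  evalWith-D0 : ∀ ρ d → evalWith ρ (D0 A H d) ≈
    evalWith ρ (lit (γN A H) ⊗ eN A H) * value ρ (y ∷ replicate d x ++ [ y⁻ ]) * evalWith ρ (eN A H)
  evalWith-D0 ρ d = *-congʳ (begin
    γE * Y₁ * evalWith ρ (powT (gen (X zero)) d) * Y₁⁻
      ≡⟨ ≡.cong (λ p → γE * Y₁ * p * Y₁⁻) (evalWith-power ρ x d) ⟩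
    γE * Y₁ * Xᵈ * Y₁⁻              ≈⟨ *-congʳ (*-assoc γE Y₁ Xᵈ) ⟩
    γE * (Y₁ * Xᵈ) * Y₁⁻            ≈⟨ *-assoc γE (Y₁ * Xᵈ) Y₁⁻ ⟩
    γE * (Y₁ * Xᵈ * Y₁⁻)            ≈⟨ *-congˡ (*-assoc Y₁ Xᵈ Y₁⁻) ⟩
    γE * (Y₁ * (Xᵈ * Y₁⁻))          ≈⟨ *-congˡ (*-congˡ (*-congˡ (*-identityʳ Y₁⁻))) ⟨
    γE * (Y₁ * (Xᵈ * (Y₁⁻ * 1#)))   ≈⟨ *-congˡ (*-congˡ (value-++ ρ (replicate d x) [ y⁻ ])) ⟨
    γE * value ρ (y ∷ replicate d x ++ [ y⁻ ]) ∎)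
    where
    γE Y₁ Y₁⁻ Xᵈ : Carrier
    γE  = evalWith ρ (lit (γN A H) ⊗ eN A H)
    Y₁  = ρ (Y zero)
    Y₁⁻ = ρ (Y⁻ zero)
    Xᵈ  = value ρ (replicate d x)

  stepsValue : List Step → Carrier
  stepsValue s = evalWith ρH (prodT (map (stepT A H) s))

  stepsValue-conjugate : ∀ s → stepsValue s * Yg zero ≈ Yg zero * value ρH (map stepLetter s)
  stepsValue-conjugate []          = trans (*-identityˡ _) (sym (*-identityʳ _))
  stepsValue-conjugate (up ∷ s)    = trans (*-assoc _ _ _) (*-congˡ (stepsValue-conjugate s))
  stepsValue-conjugate (right ∷ s) = begin
    Yg zero * Xg zero * Yig zero * stepsValue s * Yg zero     ≈⟨ *-assoc _ _ _ ⟩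
    Yg zero * Xg zero * Yig zero * (stepsValue s * Yg zero)   ≈⟨ *-congˡ (stepsValue-conjugate s) ⟩
    Yg zero * Xg zero * Yig zero * (Yg zero * W)              ≈⟨ *-assoc _ _ _ ⟩
    Yg zero * Xg zero * (Yig zero * (Yg zero * W))            ≈⟨ *-congˡ (*-assoc _ _ _) ⟨
    Yg zero * Xg zero * (Yig zero * Yg zero * W)              ≈⟨ *-congˡ (*-congʳ (Y-inv' zero)) ⟩
    Yg zero * Xg zero * (1# * W)                              ≈⟨ *-congˡ (*-identityˡ W) ⟩
    Yg zero * Xg zero * W                                     ≈⟨ *-assoc _ _ _ ⟩
    Yg zero * (Xg zero * W) ∎
    where
    W : Carrier
    W = value ρH (map stepLetter s)

  stepsValue-pathWord : ∀ s → stepsValue s ≈ value ρH (y ∷ map stepLetter s ++ [ y⁻ ])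
  stepsValue-pathWord s = begin
    stepsValue s                            ≈⟨ *-identityʳ _ ⟨
    stepsValue s * 1#                       ≈⟨ *-congˡ (Y-inv zero) ⟨
    stepsValue s * (Yg zero * Yig zero)     ≈⟨ *-assoc _ _ _ ⟨
    stepsValue s * Yg zero * Yig zero       ≈⟨ *-congʳ (stepsValue-conjugate s) ⟩
    Yg zero * W * Yig zero                  ≈⟨ *-assoc _ _ _ ⟩
    Yg zero * (W * Yig zero)                ≈⟨ *-congˡ (*-congˡ (*-identityʳ _)) ⟨
    Yg zero * (W * (Yig zero * 1#))         ≈⟨ *-congˡ (value-++ ρH (map stepLetter s) [ y⁻ ]) ⟨
    value ρH (y ∷ map stepLetter s ++ [ y⁻ ]) ∎
    where
    W : Carrier
    W = value ρH (map stepLetter s)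

  ρH-inverseRespecting : InverseRespecting ρH
  ρH-inverseRespecting x  = X-inv zero
  ρH-inverseRespecting x⁻ = X-inv' zero
  ρH-inverseRespecting y  = Y-inv zero
  ρH-inverseRespecting y⁻ = Y-inv' zero

  act-D0 : ∀ g d .{{_ : NonZero d}} →
           eval A H (act g (D0 A H d)) ≈ eval A H (Dmn A H (d *ℕ col₁ g) (d *ℕ col₂ g))
  act-D0 g d = begin
    eval A H (act g (D0 A H d))
      ≡⟨ ≡.trans (eval-evalWith (act g (D0 A H d))) (evalWith-act g ρH (D0 A H d)) ⟩
    evalWith ρ (D0 A H d)
      ≈⟨ evalWith-D0 ρ d ⟩
    evalWith ρ γeN * value ρ w * evalWith ρ (eN A H)
      ≈⟨ *-cong (*-cong (*-congˡ (eN-invariant g)) (value-braidImage g ρH w)) (eN-invariant g) ⟩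
    evalWith ρH γeN * value ρH (braidImage g w) * evalWith ρH (eN A H)
      ≈⟨ *-congʳ (*-congˡ (value-⇝* ρH-inverseRespecting (braidImage-conjugatePower g d))) ⟩
    evalWith ρH γeN * value ρH (pathWord (d *ℕ col₁ g) (d *ℕ col₂ g)) * evalWith ρH (eN A H)
      ≈⟨ *-congʳ (*-congˡ (stepsValue-pathWord (pathC (d *ℕ col₁ g) (d *ℕ col₂ g)))) ⟨
    evalWith ρH (Dmn A H (d *ℕ col₁ g) (d *ℕ col₂ g))
      ≡⟨ eval-evalWith (Dmn A H (d *ℕ col₁ g) (d *ℕ col₂ g)) ⟨
    eval A H (Dmn A H (d *ℕ col₁ g) (d *ℕ col₂ g)) ∎
    where
    ρ : Valuation
    ρ = actValuation g ρH
    γeN : Term Carrier k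
    γeN = lit (γN A H) ⊗ eN A H
    w : List FreeLetter
    w = y ∷ replicate d x ++ [ y⁻ ]


module Euclid where
  open import Data.Nat using (ℕ; zero; suc; _+_; _*_; _∸_; _≤_; _<_; _≤?_; z<s)
  open import Data.Nat.Properties
  open import Data.Nat.GCD using (gcd; module GCD; gcd-GCD; gcd-identityʳ; gcd-comm)
  open import Data.Integer using (+_)
  open import Data.List using (List; []; _∷_)
  open import Data.Product using (Σ; _×_; _,_)
  open import Relation.Nullary using (yes; no; contradiction)
  open import Relation.Binary.PropositionalEquality

  Realisable : ℕ → ℕ → Set
  Realisable m n = Σ (List BG) λ g → gcd m n * col₁ g ≡ m × gcd m n * col₂ g ≡ n

  realisable-horizontal : ∀ m → Realisable m 0
  realisable-horizontal m = [] , trans (*-identityʳ (gcd m 0)) (gcd-identityʳ m) , *-zeroʳ (gcd m 0)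

  gcd[m,m+n]≡gcd[m,n] : ∀ m n → gcd m (m + n) ≡ gcd m n
  gcd[m,m+n]≡gcd[m,n] m n = GCD.unique (gcd-GCD m (m + n)) (GCD.step (gcd-GCD m n))

  gcd[m+n,n]≡gcd[m,n] : ∀ m n → gcd (m + n) n ≡ gcd m n
  gcd[m+n,n]≡gcd[m,n] m n = begin
    gcd (m + n) n ≡⟨ gcd-comm (m + n) n ⟩
    gcd n (m + n) ≡⟨ cong (gcd n) (+-comm m n) ⟩
    gcd n (n + m) ≡⟨ gcd[m,m+n]≡gcd[m,n] n m ⟩
    gcd n m       ≡⟨ gcd-comm n m ⟩
    gcd m n       ∎
    where open ≡-Reasoning

  realisable-τ₋ : ∀ m k → Realisable m k → Realisable m (m + k)
  realisable-τ₋ m k (g , e₁ , e₂) rewrite gcd[m,m+n]≡gcd[m,n] m k =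
    τ₋ ∷ g , e₁ , trans (*-distribˡ-+ (gcd m k) (col₁ g) (col₂ g)) (cong₂ _+_ e₁ e₂)

  realisable-τ₊ : ∀ k n → Realisable k n → Realisable (k + n) n
  realisable-τ₊ k n (g , e₁ , e₂) rewrite gcd[m+n,n]≡gcd[m,n] k n =
    τ₊ ∷ g , trans (*-distribˡ-+ (gcd k n) (col₁ g) (col₂ g)) (cong₂ _+_ e₁ e₂) , e₂

  realisable : ∀ f m n → m + n ≤ f → 1 ≤ m → Realisable m n
  realisable f       m zero      _   _   = realisable-horizontal m
  realisable zero    m (suc n)   m+n≤ _  = contradiction (n≤0⇒n≡0 m+n≤) (m+1+n≢0 m)
  realisable (suc f) m n@(suc _) m+n≤ 1≤m with m ≤? n
  ... | yes m≤n = subst (Realisable m) (m+[n∸m]≡n m≤n)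
                    (realisable-τ₋ m (n ∸ m) (realisable f m (n ∸ m) fuel 1≤m))
    where
    fuel : m + (n ∸ m) ≤ f
    fuel = subst (_≤ f) (sym (m+[n∸m]≡n m≤n)) (≤-pred (<-≤-trans (m<n+m n 1≤m) m+n≤))
  ... | no m≰n = subst (λ m′ → Realisable m′ n) (m∸n+n≡m n≤m)
                   (realisable-τ₊ (m ∸ n) n (realisable f (m ∸ n) n fuel (m<n⇒0<n∸m n<m)))
    where
    n<m : n < m
    n<m = ≰⇒> m≰n
    n≤m : n ≤ m
    n≤m = <⇒≤ n<m
    fuel : m ∸ n + n ≤ f
    fuel = subst (_≤ f) (sym (m∸n+n≡m n≤m)) (≤-pred (<-≤-trans (m<m+n m z<s) m+n≤))

  braid-▷-gcdColumn : ∀ m n → 1 ≤ m → Σ (List BG) λ g → matOf g ▷ (+ gcd m n , + 0) ≡ (+ m , + n)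
  braid-▷-gcdColumn m n 1≤m with realisable (m + n) m n ≤-refl 1≤m
  ... | g , e₁ , e₂ = g , trans (matOf-▷ g (gcd m n)) (cong₂ (λ p q → (+ p , + q)) e₁ e₂)

open Euclid

lemma2p8 : {c ℓ : Level} (m n : ℕ) → 1 ≤ m → 1 ≤ n →
    Σ (List BG) (λ g → matOf g ▷ (+ gcd m n , + 0) ≡ (+ m , + n))
    × ((g : List BG) → matOf g ▷ (+ gcd m n , + 0) ≡ (+ m , + n) →
       (k : ℕ) (A : Ring c ℓ) (H : DAHA A k) →
       Ring._≈_ A (eval A H (act g (D0 A H (gcd m n)))) (eval A H (Dmn A H m n)))
lemma2p8 m n 1≤m _ = braid-▷-gcdColumn m n 1≤m , λ g g▷ k A H →
  let gcd·col₁≡m , gcd·col₂≡n = ▷-firstColumn g (gcd m n) g▷ in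
  subst₂ (λ p q → Ring._≈_ A (eval A H (act g (D0 A H (gcd m n)))) (eval A H (Dmn A H p q)))
         gcd·col₁≡m gcd·col₂≡n (Evaluation.act-D0 A H g (gcd m n))
  where
  instance
    gcd≢0 : NonZero (gcd m n)
    gcd≢0 = ≢-nonZero (gcd[m,n]≢0 m n (inj₁ (≢-nonZero⁻¹ m {{>-nonZero 1≤m}})))
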